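{- $P(2,3)=3$, and $P(2^k,3)=6$ for every integer $k>1$.
   Context: For positive integers $m,n$, let $\mathbf{Z}_m$ be the ring of integers modulo $m$ and define $T:\mathbf{Z}_m^n\to\mathbf{Z}_m^n$ by $T(a_0,\dots,a_{n-1})=(a_0+a_1,a_1+a_2,\dots,a_{n-2}+a_{n-1},a_{n-1}+a_0)$. For $\mathbf{a}\in\mathbf{Z}_m^n$, the cycle length of $(T^k\mathbf{a})_{k\ge0}$ is the smallest positive integer $P$ for which there exists $N$ with $T^{k+P}\mathbf{a}=T^k\mathbf{a}$ for all $k\ge N$. The period $P(m,n)$ is the maximum of these cycle lengths over all $\mathbf{a}\in\mathbf{Z}_m^n$. -}

module Defs where

open import Data.Nat using (ℕ; zero; suc; _+_; _≤_; _<_; NonZero)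
open import Data.Nat.DivMod using (_mod_)
open import Data.Fin using (Fin; toℕ)
open import Data.Product using (Σ; ∃; _×_)
open import Relation.Binary.PropositionalEquality using (_≡_)

-- ℤ_m is represented by Fin m (m ≥ 1), with addition modulo m.
addMod : (m : ℕ) .{{_ : NonZero m}} → Fin m → Fin m → Fin m
addMod m a b = (toℕ a + toℕ b) mod m

Vec : (m n : ℕ) → Set
Vec m n = Fin n → Fin m

nextIdx : (n : ℕ) .{{_ : NonZero n}} → Fin n → Fin n
nextIdx n i = suc (toℕ i) mod n

T : (m n : ℕ) .{{_ : NonZero m}} .{{_ : NonZero n}} → Vec m n → Vec m n
T m n a i = addMod m (a i) (a (nextIdx n i))

T^ : (m n : ℕ) .{{_ : NonZero m}} .{{_ : NonZero n}} → ℕ → Vec m n → Vec m n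
T^ m n zero    a = a
T^ m n (suc k) a = T m n (T^ m n k a)

_≈_ : ∀ {m n} → Vec m n → Vec m n → Set
a ≈ b = ∀ i → a i ≡ b i

EventuallyPeriodic : (m n : ℕ) .{{_ : NonZero m}} .{{_ : NonZero n}} →
                     Vec m n → ℕ → Set
EventuallyPeriodic m n a P =
  Σ ℕ λ N → ∀ k → N ≤ k → T^ m n (k + P) a ≈ T^ m n k a

IsCycleLength : (m n : ℕ) .{{_ : NonZero m}} .{{_ : NonZero n}} →
                Vec m n → ℕ → Set
IsCycleLength m n a P =
  0 < P × EventuallyPeriodic m n a P ×
  (∀ Q → 0 < Q → EventuallyPeriodic m n a Q → P ≤ Q)

IsPeriod : (m n : ℕ) .{{_ : NonZero m}} .{{_ : NonZero n}} → ℕ → Set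
IsPeriod m n P =
  (Σ (Vec m n) λ a → IsCycleLength m n a P) ×
  (∀ (a : Vec m n) Q → IsCycleLength m n a Q → Q ≤ P)

-- Lift T to U v i = v i + v (i + 1) on ℕⁿ and reduce modulo m afterwards. For n = 3,
-- U² = ρ + J with ρ the cyclic shift and J v = (Σ v, Σ v, Σ v); as ρ³ = 1 and J ρ = J,
-- U⁶ = 1 + 21 J, while U^j (v + c) = U^j v + 2^j c. Hence T^(k+6) = T^k on (ℤ/2^k)³, so 6 is
-- an eventual period of every orbit; on (ℤ/2)³ a finite check gives T⁴ = T. Conversely the
-- orbit of (1, −1, 0) consists of its cyclic shifts and their negatives: six distinct
-- vectors when 1 ≠ −1, three when m = 2.
module Submission where

open import Defs
open import Data.Nat using (ℕ; zero; suc; _+_; _*_; _^_; _%_; _<_; _≤_; z≤n; s≤s; NonZero; >-nonZero)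
open import Data.Nat.Properties using (m^n≢0; +-comm; +-assoc; +-identityʳ; m≤m*n; ≤-trans; ^-monoʳ-≤; m≤n⇒∃[o]m+o≡n)
open import Data.Nat.DivMod using (_mod_; m<n⇒m%n≡m; %-distribˡ-+; [m+kn]%n≡m%n; n%n≡0)
open import Data.Nat.Divisibility using (_∣_; divides; ∣-refl)
open import Data.Nat.Tactic.RingSolver using (solve-∀)
open import Data.Fin using (Fin; toℕ; fromℕ; zero; suc)
open import Data.Fin.Properties using (toℕ-injective; toℕ-fromℕ; toℕ-fromℕ<; toℕ<n; all?; _≟_)
open import Data.Product using (Σ; _×_; _,_)
open import Function using (_∘_)
open import Relation.Nullary.Decidable using (from-yes)
open import Relation.Binary.Bundles using (Setoid)
open import Relation.Binary.PropositionalEquality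
  using (_≡_; _≗_; refl; sym; trans; cong; cong₂; cong-app; _→-setoid_; module ≡-Reasoning)
import Relation.Binary.Reasoning.Setoid as SetoidReasoning

module _ {m n : ℕ} .{{_ : NonZero m}} .{{_ : NonZero n}} where

  open Setoid (Fin n →-setoid Fin m) using () renaming (trans to ≈-trans)
  open SetoidReasoning (Fin n →-setoid Fin m)

  T^-+ : ∀ j k (a : Vec m n) → T^ m n (j + k) a ≡ T^ m n j (T^ m n k a)
  T^-+ zero    k a = refl
  T^-+ (suc j) k a = cong (T m n) (T^-+ j k a)

  T^-cong : ∀ j {a b : Vec m n} → a ≈ b → T^ m n j a ≈ T^ m n j b
  T^-cong zero    a≈b = a≈b
  T^-cong (suc j) a≈b i = cong₂ (addMod m) (T^-cong j a≈b i) (T^-cong j a≈b (nextIdx n i))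

  T^-periodic-* : ∀ P {a : Vec m n} → T^ m n P a ≈ a → ∀ N → T^ m n (N * P) a ≈ a
  T^-periodic-* P periodic zero    i = refl
  T^-periodic-* P {a} periodic (suc N) = begin
    T^ m n (P + N * P) a       ≡⟨ T^-+ P (N * P) a ⟩
    T^ m n P (T^ m n (N * P) a) ≈⟨ T^-cong P (T^-periodic-* P periodic N) ⟩
    T^ m n P a                 ≈⟨ periodic ⟩
    a                          ∎

  uniform⇒eventuallyPeriodic : ∀ N P → (∀ b → T^ m n (N + P) b ≈ T^ m n N b) →
                               ∀ a → EventuallyPeriodic m n a P
  uniform⇒eventuallyPeriodic N P uniform a = N , periodicFrom
    where
    periodicFrom : ∀ k → N ≤ k → T^ m n (k + P) a ≈ T^ m n k a
    periodicFrom k N≤k with m≤n⇒∃[o]m+o≡n N≤k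
    ... | o , refl = begin
      T^ m n (N + o + P) a         ≡⟨ cong (λ j → T^ m n j a) (N+o+P≡N+P+o N o P) ⟩
      T^ m n (N + P + o) a         ≡⟨ T^-+ (N + P) o a ⟩
      T^ m n (N + P) (T^ m n o a)  ≈⟨ uniform (T^ m n o a) ⟩
      T^ m n N (T^ m n o a)        ≡⟨ T^-+ N o a ⟨
      T^ m n (N + o) a             ∎
      where
      N+o+P≡N+P+o : ∀ N o P → N + o + P ≡ N + P + o
      N+o+P≡N+P+o = solve-∀

  periodic⇒eventualPeriod-fixes : ∀ P .{{_ : NonZero P}} {a : Vec m n} → T^ m n P a ≈ a →
                                  ∀ Q → EventuallyPeriodic m n a Q → T^ m n Q a ≈ a
  periodic⇒eventualPeriod-fixes P {a} periodic Q (N , eventually) = begin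
    T^ m n Q a                     ≈⟨ T^-cong Q (T^-periodic-* P periodic N) ⟨
    T^ m n Q (T^ m n (N * P) a)    ≡⟨ T^-+ Q (N * P) a ⟨
    T^ m n (Q + N * P) a           ≡⟨ cong (λ j → T^ m n j a) (+-comm Q (N * P)) ⟩
    T^ m n (N * P + Q) a           ≈⟨ eventually (N * P) (m≤m*n N P) ⟩
    T^ m n (N * P) a               ≈⟨ T^-periodic-* P periodic N ⟩
    a                              ∎

  periodic⇒isCycleLength : ∀ P {a : Vec m n} → 0 < P → T^ m n P a ≈ a →
                           (∀ Q → 0 < Q → T^ m n Q a ≈ a → P ≤ Q) → IsCycleLength m n a P
  periodic⇒isCycleLength P {a} 0<P periodic minimal =
    0<P , (0 , λ k _ → periodicFrom k) ,
    λ Q 0<Q eventual → minimal Q 0<Q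
      (periodic⇒eventualPeriod-fixes P {{>-nonZero 0<P}} periodic Q eventual)
    where
    periodicFrom : ∀ k → T^ m n (k + P) a ≈ T^ m n k a
    periodicFrom k = ≈-trans (cong-app (T^-+ k P a)) (T^-cong k periodic)

  isPeriod-intro : ∀ {P} → (Σ (Vec m n) λ a → IsCycleLength m n a P) →
                   (∀ b → EventuallyPeriodic m n b P) → IsPeriod m n P
  isPeriod-intro {P} witness@(_ , 0<P , _) eventual =
    witness , λ b Q (_ , _ , minimal) → minimal P 0<P (eventual b)

toℕ-addMod : ∀ m .{{_ : NonZero m}} (x y : Fin m) → toℕ (addMod m x y) ≡ (toℕ x + toℕ y) % m
toℕ-addMod m x y = toℕ-fromℕ< _

addMod-comm : ∀ m .{{_ : NonZero m}} (x y : Fin m) → addMod m x y ≡ addMod m y x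
addMod-comm m x y = cong (_mod m) (+-comm (toℕ x) (toℕ y))

addMod-identityˡ : ∀ m (x : Fin (suc m)) → addMod (suc m) zero x ≡ x
addMod-identityˡ m x = toℕ-injective (trans (toℕ-addMod (suc m) zero x) (m<n⇒m%n≡m (toℕ<n x)))

addMod-identityʳ : ∀ m (x : Fin (suc m)) → addMod (suc m) x zero ≡ x
addMod-identityʳ m x = trans (addMod-comm (suc m) x zero) (addMod-identityˡ m x)

addMod-one-minusOne : ∀ m → addMod (suc (suc m)) (suc zero) (fromℕ (suc m)) ≡ zero
addMod-one-minusOne m = toℕ-injective (begin
  toℕ (addMod (suc (suc m)) (suc zero) (fromℕ (suc m))) ≡⟨ toℕ-addMod (suc (suc m)) (suc zero) (fromℕ (suc m)) ⟩
  suc (toℕ (fromℕ (suc m))) % suc (suc m)              ≡⟨ cong (λ k → suc k % suc (suc m)) (toℕ-fromℕ (suc m)) ⟩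
  suc (suc m) % suc (suc m)                            ≡⟨ n%n≡0 (suc (suc m)) ⟩
  0                                                    ∎)
  where open ≡-Reasoning

module _ {n : ℕ} .{{_ : NonZero n}} where

  U : (Fin n → ℕ) → Fin n → ℕ
  U v i = v i + v (nextIdx n i)

  U^ : ℕ → (Fin n → ℕ) → Fin n → ℕ
  U^ zero    v = v
  U^ (suc j) v = U (U^ j v)

  U^-+ : ∀ j k v → U^ (j + k) v ≡ U^ j (U^ k v)
  U^-+ zero    k v = refl
  U^-+ (suc j) k v = cong U (U^-+ j k v)

  U^-cong : ∀ j {v w} → v ≗ w → U^ j v ≗ U^ j w
  U^-cong zero    v≗w = v≗w
  U^-cong (suc j) v≗w i = cong₂ _+_ (U^-cong j v≗w i) (U^-cong j v≗w (nextIdx n i))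

  U^-+const : ∀ j v c i → U^ j (λ k → v k + c) i ≡ U^ j v i + 2 ^ j * c
  U^-+const zero    v c i = cong (v i +_) (sym (+-identityʳ c))
  U^-+const (suc j) v c i =
    trans (cong₂ _+_ (U^-+const j v c i) (U^-+const j v c (nextIdx n i)))
          (regroup (U^ j v i) (U^ j v (nextIdx n i)) (2 ^ j) c)
    where
    regroup : ∀ x y d c → (x + d * c) + (y + d * c) ≡ (x + y) + 2 * d * c
    regroup = solve-∀

  toℕ-T^ : ∀ {m} .{{_ : NonZero m}} j (a : Vec m n) i → toℕ (T^ m n j a i) ≡ U^ j (toℕ ∘ a) i % m
  toℕ-T^ {m} zero    a i = sym (m<n⇒m%n≡m (toℕ<n (a i)))
  toℕ-T^ {m} (suc j) a i = begin
    toℕ (addMod m (T^ m n j a i) (T^ m n j a (nextIdx n i)))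
      ≡⟨ toℕ-addMod m (T^ m n j a i) (T^ m n j a (nextIdx n i)) ⟩
    (toℕ (T^ m n j a i) + toℕ (T^ m n j a (nextIdx n i))) % m
      ≡⟨ cong₂ (λ x y → (x + y) % m) (toℕ-T^ j a i) (toℕ-T^ j a (nextIdx n i)) ⟩
    (U^ j (toℕ ∘ a) i % m + U^ j (toℕ ∘ a) (nextIdx n i) % m) % m
      ≡⟨ %-distribˡ-+ (U^ j (toℕ ∘ a) i) (U^ j (toℕ ∘ a) (nextIdx n i)) m ⟨
    U^ (suc j) (toℕ ∘ a) i % m
      ∎
    where open ≡-Reasoning

vec3 : ∀ {A : Set} → A → A → A → Fin 3 → A
vec3 x y z zero                = x
vec3 x y z (suc zero)          = y
vec3 x y z (suc (suc zero))    = z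

vec3-η : ∀ {A : Set} (v : Fin 3 → A) → v ≗ vec3 (v zero) (v (suc zero)) (v (suc (suc zero)))
vec3-η v zero             = refl
vec3-η v (suc zero)       = refl
vec3-η v (suc (suc zero)) = refl

next : Fin 3 → Fin 3
next = nextIdx 3

next³ : ∀ i → next (next (next i)) ≡ i
next³ zero             = refl
next³ (suc zero)       = refl
next³ (suc (suc zero)) = refl

sum₃ : (Fin 3 → ℕ) → ℕ
sum₃ v = v zero + v (suc zero) + v (suc (suc zero))

sum₃-from : ∀ v i → v i + v (next i) + v (next (next i)) ≡ sum₃ v
sum₃-from v zero             = refl
sum₃-from v (suc zero)       = rotate (v zero) (v (suc zero)) (v (suc (suc zero)))
  where
  rotate : ∀ a b c → b + c + a ≡ a + b + c
  rotate = solve-∀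
sum₃-from v (suc (suc zero)) = rotate (v zero) (v (suc zero)) (v (suc (suc zero)))
  where
  rotate : ∀ a b c → c + a + b ≡ a + b + c
  rotate = solve-∀

sum₃-next : ∀ v → sum₃ (v ∘ next) ≡ sum₃ v
sum₃-next v = sum₃-from v (suc zero)

U²≡next+sum₃ : ∀ v i → U^ 2 v i ≡ v (next i) + sum₃ v
U²≡next+sum₃ v i = trans (regroup (v i) (v (next i)) (v (next (next i))))
                          (cong (v (next i) +_) (sum₃-from v i))
  where
  regroup : ∀ a b c → (a + b) + (b + c) ≡ b + (a + b + c)
  regroup = solve-∀

U²-+const : ∀ v c i → U^ 2 (λ j → v j + c) i ≡ v (next i) + (sum₃ v + 4 * c)
U²-+const v c i = begin
  U^ 2 (λ j → v j + c) i          ≡⟨ U^-+const 2 v c i ⟩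
  U^ 2 v i + 4 * c                ≡⟨ cong (_+ 4 * c) (U²≡next+sum₃ v i) ⟩
  v (next i) + sum₃ v + 4 * c     ≡⟨ +-assoc (v (next i)) (sum₃ v) (4 * c) ⟩
  v (next i) + (sum₃ v + 4 * c)   ∎
  where open ≡-Reasoning

U⁶≡id+21sum₃ : ∀ v i → U^ 6 v i ≡ v i + 21 * sum₃ v
U⁶≡id+21sum₃ v i = begin
  U^ 2 (U^ 2 (U^ 2 v)) i
    ≡⟨ U^-cong 2 (U^-cong 2 (U²≡next+sum₃ v)) i ⟩
  U^ 2 (U^ 2 (λ j → v (next j) + s)) i
    ≡⟨ U^-cong 2 (U²-+const (v ∘ next) s) i ⟩
  U^ 2 (λ j → v (next (next j)) + (sum₃ (v ∘ next) + 4 * s)) i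
    ≡⟨ U²-+const (v ∘ next ∘ next) (sum₃ (v ∘ next) + 4 * s) i ⟩
  v (next (next (next i))) + (sum₃ (v ∘ next ∘ next) + 4 * (sum₃ (v ∘ next) + 4 * s))
    ≡⟨ cong₂ _+_ (cong v (next³ i))
                 (cong₂ (λ x y → x + 4 * (y + 4 * s)) (trans (sum₃-next (v ∘ next)) (sum₃-next v)) (sum₃-next v)) ⟩
  v i + (s + 4 * (s + 4 * s))
    ≡⟨ cong (v i +_) (collect s) ⟩
  v i + 21 * s
    ∎
  where
  open ≡-Reasoning
  s : ℕ
  s = sum₃ v
  collect : ∀ s → s + 4 * (s + 4 * s) ≡ 21 * s
  collect = solve-∀

T^[k+6]≈T^[k] : ∀ {M} .{{_ : NonZero M}} k → M ∣ 2 ^ k → ∀ (b : Vec M 3) → T^ M 3 (k + 6) b ≈ T^ M 3 k b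
T^[k+6]≈T^[k] {M} k (divides q 2^k≡q*M) b i = toℕ-injective (begin
  toℕ (T^ M 3 (k + 6) b i)                        ≡⟨ toℕ-T^ (k + 6) b i ⟩
  U^ (k + 6) v i % M                              ≡⟨ cong (_% M) (cong-app (U^-+ k 6 v) i) ⟩
  U^ k (U^ 6 v) i % M                             ≡⟨ cong (_% M) (U^-cong k (U⁶≡id+21sum₃ v) i) ⟩
  U^ k (λ j → v j + c) i % M                      ≡⟨ cong (_% M) (U^-+const k v c i) ⟩
  (U^ k v i + 2 ^ k * c) % M                      ≡⟨ cong (λ x → (U^ k v i + x * c) % M) 2^k≡q*M ⟩
  (U^ k v i + q * M * c) % M                      ≡⟨ cong (λ x → (U^ k v i + x) % M) (swap q M c) ⟩
  (U^ k v i + q * c * M) % M                      ≡⟨ [m+kn]%n≡m%n (U^ k v i) (q * c) M ⟩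
  U^ k v i % M                                    ≡⟨ toℕ-T^ k b i ⟨
  toℕ (T^ M 3 k b i)                              ∎)
  where
  open ≡-Reasoning
  v : Fin 3 → ℕ
  v = toℕ ∘ b
  c : ℕ
  c = 21 * sum₃ v
  swap : ∀ q M c → q * M * c ≡ q * c * M
  swap = solve-∀

T⁴≈T-on-ℤ₂ : ∀ (b : Vec 2 3) → T^ 2 3 (1 + 3) b ≈ T^ 2 3 1 b
T⁴≈T-on-ℤ₂ b = begin
  T^ 2 3 4 b                                    ≈⟨ T^-cong 4 (vec3-η b) ⟩
  T^ 2 3 4 (vec3 (b zero) (b (suc zero)) (b (suc (suc zero))))
                                                ≈⟨ table (b zero) (b (suc zero)) (b (suc (suc zero))) ⟩
  T^ 2 3 1 (vec3 (b zero) (b (suc zero)) (b (suc (suc zero))))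
                                                ≈⟨ T^-cong 1 (vec3-η b) ⟨
  T^ 2 3 1 b                                    ∎
  where
  open SetoidReasoning (Fin 3 →-setoid Fin 2)
  table : ∀ x y z i → T^ 2 3 4 (vec3 x y z) i ≡ T^ 2 3 1 (vec3 x y z) i
  table = from-yes (all? λ x → all? λ y → all? λ z → all? λ i →
                    T^ 2 3 4 (vec3 x y z) i ≟ T^ 2 3 1 (vec3 x y z) i)

module HalfOrbit {m : ℕ} (x y : Fin (suc m)) (x+y≡0 : addMod (suc m) x y ≡ zero) where

  private
    M : ℕ
    M = suc m
    y+x≡0 : addMod M y x ≡ zero
    y+x≡0 = trans (addMod-comm M y x) x+y≡0
    open Setoid (Fin 3 →-setoid Fin M) using () renaming (trans to ≈-trans)

  step₁ : T M 3 (vec3 x y zero) ≈ vec3 zero y x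
  step₁ zero             = x+y≡0
  step₁ (suc zero)       = addMod-identityʳ m y
  step₁ (suc (suc zero)) = addMod-identityˡ m x

  step₂ : T M 3 (vec3 zero y x) ≈ vec3 y zero x
  step₂ zero             = addMod-identityˡ m y
  step₂ (suc zero)       = y+x≡0
  step₂ (suc (suc zero)) = addMod-identityʳ m x

  step₃ : T M 3 (vec3 y zero x) ≈ vec3 y x zero
  step₃ zero             = addMod-identityʳ m y
  step₃ (suc zero)       = addMod-identityˡ m x
  step₃ (suc (suc zero)) = x+y≡0

  T²≈ : T^ M 3 2 (vec3 x y zero) ≈ vec3 y zero x
  T²≈ = ≈-trans (T^-cong 1 step₁) step₂

  T³≈swap : T^ M 3 3 (vec3 x y zero) ≈ vec3 y x zero
  T³≈swap = ≈-trans (T^-cong 1 T²≈) step₃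

module Antipode (p : ℕ) where

  private
    M : ℕ
    M = suc (suc p)
    one minusOne : Fin M
    one      = suc zero
    minusOne = fromℕ (suc p)
    one+minusOne≡0 : addMod M one minusOne ≡ zero
    one+minusOne≡0 = addMod-one-minusOne p
    minusOne+one≡0 : addMod M minusOne one ≡ zero
    minusOne+one≡0 = trans (addMod-comm M minusOne one) one+minusOne≡0
    open Setoid (Fin 3 →-setoid Fin M) using () renaming (trans to ≈-trans)

  module Forth = HalfOrbit {suc p} one minusOne one+minusOne≡0
  module Back  = HalfOrbit {suc p} minusOne one minusOne+one≡0

  antipode : Vec M 3
  antipode = vec3 one minusOne zero

  T⁶≈id : T^ M 3 6 antipode ≈ antipode
  T⁶≈id = ≈-trans (T^-cong 3 Forth.T³≈swap) Back.T³≈swap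

  T⁴≈ : T^ M 3 4 antipode ≈ vec3 zero one minusOne
  T⁴≈ = ≈-trans (T^-cong 1 Forth.T³≈swap) Back.step₁

  T⁵≈ : T^ M 3 5 antipode ≈ vec3 one zero minusOne
  T⁵≈ = ≈-trans (T^-cong 1 T⁴≈) Back.step₂

  coincide : ∀ Q {b} i → T^ M 3 Q antipode ≈ b → T^ M 3 Q antipode ≈ antipode → b i ≡ antipode i
  coincide Q i orbit periodic = trans (sym (orbit i)) (periodic i)

-- In ℤ/2 we have −1 = 1, so the swap reached after three steps is the antipode itself.
antipode-cycleLength₃ : IsCycleLength 2 3 (Antipode.antipode 0) 3
antipode-cycleLength₃ = periodic⇒isCycleLength 3 (s≤s z≤n) Forth.T³≈swap minimal
  where
  open Antipode 0
  minimal : ∀ Q → 0 < Q → T^ 2 3 Q antipode ≈ antipode → 3 ≤ Q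
  minimal 1 _ periodic with coincide 1 zero Forth.step₁ periodic
  ... | ()
  minimal 2 _ periodic with coincide 2 (suc zero) Forth.T²≈ periodic
  ... | ()
  minimal (suc (suc (suc Q))) _ _ = s≤s (s≤s (s≤s z≤n))

antipode-cycleLength₆ : ∀ {M} .{{_ : NonZero M}} → 3 ≤ M → Σ (Vec M 3) λ a → IsCycleLength M 3 a 6
antipode-cycleLength₆ {.(suc (suc (suc p)))} (s≤s (s≤s (s≤s {n = p} _))) =
  antipode , periodic⇒isCycleLength 6 (s≤s z≤n) T⁶≈id minimal
  where
  open Antipode (suc p)
  minimal : ∀ Q → 0 < Q → T^ (3 + p) 3 Q antipode ≈ antipode → 6 ≤ Q
  minimal 1 _ periodic with coincide 1 zero Forth.step₁ periodic
  ... | ()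
  minimal 2 _ periodic with coincide 2 zero Forth.T²≈ periodic
  ... | ()
  minimal 3 _ periodic with coincide 3 zero Forth.T³≈swap periodic
  ... | ()
  minimal 4 _ periodic with coincide 4 zero T⁴≈ periodic
  ... | ()
  minimal 5 _ periodic with coincide 5 (suc zero) T⁵≈ periodic
  ... | ()
  minimal (suc (suc (suc (suc (suc (suc Q)))))) _ _ = s≤s (s≤s (s≤s (s≤s (s≤s (s≤s z≤n)))))

3≤2^k : ∀ k → 1 < k → 3 ≤ 2 ^ k
3≤2^k k 1<k = ≤-trans (s≤s (s≤s (s≤s z≤n))) (^-monoʳ-≤ 2 1<k)

period-2^k : ∀ k → 1 < k → IsPeriod (2 ^ k) 3 {{m^n≢0 2 k}} 6
period-2^k k 1<k =
  isPeriod-intro (antipode-cycleLength₆ (3≤2^k k 1<k))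
    (uniform⇒eventuallyPeriodic k 6 (T^[k+6]≈T^[k] k ∣-refl))
  where
  instance
    2^k≢0 : NonZero (2 ^ k)
    2^k≢0 = m^n≢0 2 k

proposition5p2 : IsPeriod 2 3 3 × (∀ (k : ℕ) → 1 < k → IsPeriod (2 ^ k) 3 {{m^n≢0 2 k}} 6)
proposition5p2 =
  isPeriod-intro (Antipode.antipode 0 , antipode-cycleLength₃)
    (uniform⇒eventuallyPeriodic 1 3 T⁴≈T-on-ℤ₂) ,
  period-2^k
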